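{- For every positive integer $n$, $\omega(n) = \nu_2(\mathcal{N}(4n)) - 1$.
   Context: $\omega(n)$ is the number of distinct prime divisors of $n$; $\nu_2(m)$ is the exponent of $2$ in the prime factorization of the positive integer $m$. For $n>0$, $\mathcal{N}(n)=|\{a\in\{0,\dots,n-1\}: a^2\equiv 1 \pmod n\}|$. -}

module Defs where

open import Data.Nat using (ℕ; zero; suc; _+_; _*_; _^_; _%_; _/_; NonZero; _≟_)
open import Data.Nat.Divisibility using (_∣_; _∣?_)
open import Data.Nat.Primality using (Prime; prime?)
open import Data.List using (List; filter; length; upTo)
open import Data.Product using (_×_)
open import Relation.Nullary using (¬_; _×-dec_)

-- ω(n): number of distinct primes p with p ∣ n (all such p satisfy p < n + 1 when n > 0)
ω : ℕ → ℕ
ω n = length (filter (λ p → prime? p ×-dec (p ∣? n)) (upTo (suc n)))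

𝒩 : (n : ℕ) → .{{NonZero n}} → ℕ
𝒩 n = length (filter (λ a → ((a * a) % n) ≟ (1 % n)) (upTo n))

ν₂-go : ℕ → ℕ → ℕ
ν₂-go zero m = 0
ν₂-go (suc fuel) m with m % 2 ≟ 0
... | Relation.Nullary.yes _ = suc (ν₂-go fuel (m / 2))
... | Relation.Nullary.no _ = 0

ν₂ : ℕ → ℕ
ν₂ m = ν₂-go m m

{-# OPTIONS --safe #-}
module Submission where

-- Writing an odd a as 2b + 1 gives a² = 1 + 4·b(b+1), so a² ≡ 1 (mod 4n) iff n ∣ b(b+1); an even a
-- is never a square root of 1 modulo an even modulus. Since b ↦ [n ∣ b(b+1)] has period n, counting
-- a < 4n yields 𝒩(4n) = 2·ρ(n), where ρ(n) = pronicRoots n is the number of b < n with n ∣ b(b+1).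
-- By the Chinese remainder theorem ρ is multiplicative, and since b and b + 1 are coprime a prime
-- power dividing b(b+1) divides one of them, so ρ(pᵉ) = 2 (the roots b ≡ 0 and b ≡ -1). Hence
-- ρ(n) = 2^ω(n) and 𝒩(4n) = 2^(ω(n)+1).

open import Data.Nat
open import Data.Nat.Properties
open import Data.Nat.DivMod
open import Data.Nat.Divisibility
open import Data.Nat.Coprimality using (Coprime; coprime-divisor)
import Data.Nat.Coprimality as Coprimality
open import Data.Nat.Primality
open import Data.Nat.Primality.Factorisation using (factorise)
open import Data.Nat.Induction using (<-wellFounded; Acc; acc)
open import Data.Nat.Tactic.RingSolver using (solve-∀)
open import Data.List using (_∷_; [_]; _++_; filter; length; upTo)
open import Data.List.Properties using (upTo-∷ʳ; filter-++; length-++)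
import Data.List.Relation.Unary.All as All
open import Data.Product using (∃; ∃₂; _×_; _,_; proj₁; proj₂)
open import Data.Sum using (_⊎_; inj₁; inj₂)
open import Function using (_∘_; case_of_)
open import Relation.Nullary using (Dec; yes; no; ¬_; _×-dec_; contradiction)
open import Relation.Unary using (Pred; Decidable)
open import Relation.Binary.PropositionalEquality
  using (_≡_; _≢_; refl; sym; trans; cong; cong₂; subst; module ≡-Reasoning)
open import Defs

𝟙 : ∀ {a} {A : Set a} → Dec A → ℕ
𝟙 (yes _) = 1
𝟙 (no _)  = 0

module _ {a} {A : Set a} where

  𝟙-yes : (a? : Dec A) → A → 𝟙 a? ≡ 1
  𝟙-yes (yes _) _ = refl
  𝟙-yes (no ¬a) a = contradiction a ¬a

  𝟙-no : (a? : Dec A) → ¬ A → 𝟙 a? ≡ 0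
  𝟙-no (yes a) ¬a = contradiction a ¬a
  𝟙-no (no _)  _  = refl

module _ {a b} {A : Set a} {B : Set b} where

  𝟙-cong : (a? : Dec A) (b? : Dec B) → (A → B) → (B → A) → 𝟙 a? ≡ 𝟙 b?
  𝟙-cong (yes a) b? to from = sym (𝟙-yes b? (to a))
  𝟙-cong (no ¬a) b? to from = sym (𝟙-no b? (¬a ∘ from))

  𝟙-×-dec : (a? : Dec A) (b? : Dec B) → 𝟙 (a? ×-dec b?) ≡ 𝟙 a? * 𝟙 b?
  𝟙-×-dec (yes _) (yes _) = refl
  𝟙-×-dec (yes _) (no _)  = refl
  𝟙-×-dec (no _)  _       = refl

∑< : ℕ → (ℕ → ℕ) → ℕ
∑< zero    f = 0
∑< (suc n) f = ∑< n f + f n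

infixl 10 ∑<
syntax ∑< n (λ i → x) = ∑[ i < n ] x

length-filter-upTo : ∀ {p} {P : Pred ℕ p} (P? : Decidable P) n →
                     length (filter P? (upTo n)) ≡ ∑[ i < n ] 𝟙 (P? i)
length-filter-upTo P? zero    = refl
length-filter-upTo P? (suc n) = begin
  length (filter P? (upTo (suc n)))                      ≡⟨ cong (length ∘ filter P?) (upTo-∷ʳ n) ⟨
  length (filter P? (upTo n ++ [ n ]))                   ≡⟨ cong length (filter-++ P? (upTo n) [ n ]) ⟩
  length (filter P? (upTo n) ++ filter P? [ n ])         ≡⟨ length-++ (filter P? (upTo n)) ⟩
  length (filter P? (upTo n)) + length (filter P? [ n ]) ≡⟨ cong₂ _+_ (length-filter-upTo P? n) last ⟩
  ∑[ i < suc n ] 𝟙 (P? i)                                ∎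
  where
  open ≡-Reasoning
  last : length (filter P? [ n ]) ≡ 𝟙 (P? n)
  last with P? n
  ... | yes _ = refl
  ... | no _  = refl

∑-cong : ∀ n {f g : ℕ → ℕ} → (∀ {i} → i < n → f i ≡ g i) → ∑< n f ≡ ∑< n g
∑-cong zero    eq = refl
∑-cong (suc n) eq = cong₂ _+_ (∑-cong n (eq ∘ m<n⇒m<1+n)) (eq (n<1+n n))

∑-const : ∀ n c → ∑[ i < n ] c ≡ n * c
∑-const zero    c = refl
∑-const (suc n) c = trans (cong (_+ c) (∑-const n c)) (+-comm (n * c) c)

∑-zero : ∀ n {f : ℕ → ℕ} → (∀ {i} → i < n → f i ≡ 0) → ∑< n f ≡ 0
∑-zero n eq = trans (∑-cong n eq) (trans (∑-const n 0) (*-zeroʳ n))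

∑-distrib-+ : ∀ n (f g : ℕ → ℕ) → ∑[ i < n ] (f i + g i) ≡ ∑< n f + ∑< n g
∑-distrib-+ zero    f g = refl
∑-distrib-+ (suc n) f g = trans (cong (_+ (f n + g n)) (∑-distrib-+ n f g))
                                (+-interchange (∑< n f) (∑< n g) (f n) (g n))
  where
  +-interchange : ∀ a b c d → (a + b) + (c + d) ≡ (a + c) + (b + d)
  +-interchange = solve-∀

*-distribˡ-∑ : ∀ n c (f : ℕ → ℕ) → c * ∑< n f ≡ ∑[ i < n ] (c * f i)
*-distribˡ-∑ zero    c f = *-zeroʳ c
*-distribˡ-∑ (suc n) c f =
  trans (*-distribˡ-+ c (∑< n f) (f n)) (cong (_+ c * f n) (*-distribˡ-∑ n c f))

*-distribʳ-∑ : ∀ n c (f : ℕ → ℕ) → ∑< n f * c ≡ ∑[ i < n ] (f i * c)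
*-distribʳ-∑ n c f =
  trans (*-comm (∑< n f) c) (trans (*-distribˡ-∑ n c f) (∑-cong n (λ {i} _ → *-comm c (f i))))

∑-split : ∀ m n (f : ℕ → ℕ) → ∑[ i < m + n ] f i ≡ ∑< m f + ∑[ j < n ] f (m + j)
∑-split m zero    f = trans (cong (λ k → ∑< k f) (+-identityʳ m)) (sym (+-identityʳ (∑< m f)))
∑-split m (suc n) f = begin
  ∑< (m + suc n) f                           ≡⟨ cong (λ k → ∑< k f) (+-suc m n) ⟩
  ∑< (m + n) f + f (m + n)                   ≡⟨ cong (_+ f (m + n)) (∑-split m n f) ⟩
  ∑< m f + ∑[ j < n ] f (m + j) + f (m + n)  ≡⟨ +-assoc (∑< m f) _ _ ⟩
  ∑< m f + ∑[ j < suc n ] f (m + j)          ∎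
  where open ≡-Reasoning

∑-blocks : ∀ k m (f : ℕ → ℕ) → ∑[ a < k * m ] f a ≡ ∑[ q < k ] ∑[ r < m ] f (m * q + r)
∑-blocks zero    m f = refl
∑-blocks (suc k) m f = begin
  ∑< (m + k * m) f                         ≡⟨ cong (λ n → ∑< n f) (+-comm m (k * m)) ⟩
  ∑< (k * m + m) f                         ≡⟨ ∑-split (k * m) m f ⟩
  ∑< (k * m) f + ∑[ r < m ] f (k * m + r)  ≡⟨ cong₂ _+_ (∑-blocks k m f) (∑-cong m (λ _ → k*m≡m*k _)) ⟩
  ∑[ q < suc k ] ∑[ r < m ] f (m * q + r)  ∎
  where
  open ≡-Reasoning
  k*m≡m*k : ∀ r → f (k * m + r) ≡ f (m * k + r)
  k*m≡m*k r = cong (λ a → f (a + r)) (*-comm k m)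

∑-comm : ∀ m n (f : ℕ → ℕ → ℕ) → ∑[ i < m ] ∑[ j < n ] f i j ≡ ∑[ j < n ] ∑[ i < m ] f i j
∑-comm zero    n f = sym (∑-zero n (λ _ → refl))
∑-comm (suc m) n f = trans (cong (_+ ∑[ j < n ] f m j) (∑-comm m n f))
                           (sym (∑-distrib-+ n (λ j → ∑[ i < m ] f i j) (f m)))

∑-sift : ∀ n (g : ℕ → ℕ) {i} → i < n → ∑[ j < n ] (𝟙 (i ≟ j) * g j) ≡ g i
∑-sift (suc n) g {i} i<1+n with i ≟ n
... | yes refl = cong₂ _+_ (∑-zero i (λ j<i → cong (_* g _) (𝟙-no (i ≟ _) (>⇒≢ j<i))))
                           (*-identityˡ (g i))
... | no i≢n   = trans (+-identityʳ _) (∑-sift n g (≤∧≢⇒< (s≤s⁻¹ i<1+n) i≢n))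

∑-δ : ∀ n {i} → i < n → ∑[ j < n ] 𝟙 (i ≟ j) ≡ 1
∑-δ n {i} i<n =
  trans (∑-cong n (λ {j} _ → sym (*-identityʳ (𝟙 (i ≟ j))))) (∑-sift n (λ _ → 1) i<n)

∑-≤ : ∀ n {f : ℕ → ℕ} {c} → (∀ {i} → i < n → f i ≤ c) → ∑< n f ≤ n * c
∑-≤ zero            le = z≤n
∑-≤ (suc n) {f} {c} le = subst (∑< (suc n) f ≤_) (+-comm (n * c) c)
                               (+-mono-≤ (∑-≤ n (le ∘ m<n⇒m<1+n)) (le (n<1+n n)))

+-tight : ∀ {a b x y} → a ≤ x → b ≤ y → a + b ≡ x + y → a ≡ x × b ≡ y
+-tight {a} {b} a≤x b≤y eq with m≤n⇒m<n∨m≡n a≤x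
... | inj₁ a<x  = contradiction eq (<⇒≢ (+-mono-<-≤ a<x b≤y))
... | inj₂ refl = refl , +-cancelˡ-≡ a b _ eq

∑-tight : ∀ n {f : ℕ → ℕ} {c} → (∀ {i} → i < n → f i ≤ c) → ∑< n f ≡ n * c →
          ∀ {i} → i < n → f i ≡ c
∑-tight (suc n) {f} {c} le sum≡ i<1+n = case m<1+n⇒m<n∨m≡n i<1+n of λ where
    (inj₁ i<n)  → ∑-tight n le′ (proj₁ tight) i<n
    (inj₂ refl) → proj₂ tight
  where
  le′ : ∀ {i} → i < n → f i ≤ c
  le′ = le ∘ m<n⇒m<1+n
  tight : ∑< n f ≡ n * c × f n ≡ c
  tight = +-tight (∑-≤ n le′) (le (n<1+n n)) (trans sum≡ (+-comm c (n * c)))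

-- Every fibre of an injective f has at most one point and the fibres over {0, …, m-1} have m points
-- in total, so each has exactly one: f permutes {0, …, m-1}.
module _ {m} {f : ℕ → ℕ} (f-bounded : ∀ {x} → x < m → f x < m)
         (f-injective : ∀ {x y} → x < m → y < m → f x ≡ f y → x ≡ y) where

  private
    fibre : ℕ → ℕ
    fibre y = ∑[ x < m ] 𝟙 (f x ≟ y)

    fibre≤1 : ∀ y → fibre y ≤ 1
    fibre≤1 y with anyUpTo? (λ x → f x ≟ y) m
    ... | yes (x₀ , x₀<m , refl) = ≤-reflexive (trans (∑-cong m same-point) (∑-δ m x₀<m))
      where
      same-point : ∀ {x} → x < m → 𝟙 (f x ≟ f x₀) ≡ 𝟙 (x₀ ≟ x)
      same-point x<m = 𝟙-cong _ _ (sym ∘ f-injective x<m x₀<m) (cong f ∘ sym)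
    ... | no ∄x = subst (_≤ 1) (sym (∑-zero m outside-image)) z≤n
      where
      outside-image : ∀ {x} → x < m → 𝟙 (f x ≟ y) ≡ 0
      outside-image {x} x<m = 𝟙-no _ (λ fx≡y → ∄x (x , x<m , fx≡y))

    ∑-fibre : ∑< m fibre ≡ m
    ∑-fibre = begin
      ∑[ y < m ] ∑[ x < m ] 𝟙 (f x ≟ y)  ≡⟨ ∑-comm m m _ ⟨
      ∑[ x < m ] ∑[ y < m ] 𝟙 (f x ≟ y)  ≡⟨ ∑-cong m (∑-δ m ∘ f-bounded) ⟩
      ∑[ x < m ] 1                       ≡⟨ ∑-const m 1 ⟩
      m * 1                              ≡⟨ *-identityʳ m ⟩
      m                                  ∎
      where open ≡-Reasoning

    fibre≡1 : ∀ {y} → y < m → fibre y ≡ 1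
    fibre≡1 = ∑-tight m (λ {y} _ → fibre≤1 y) (trans ∑-fibre (sym (*-identityʳ m)))

  ∑-reindex : ∀ (g : ℕ → ℕ) → ∑[ x < m ] g (f x) ≡ ∑< m g
  ∑-reindex g = begin
    ∑[ x < m ] g (f x)                         ≡⟨ ∑-cong m (∑-sift m g ∘ f-bounded) ⟨
    ∑[ x < m ] ∑[ y < m ] (𝟙 (f x ≟ y) * g y)  ≡⟨ ∑-comm m m _ ⟩
    ∑[ y < m ] ∑[ x < m ] (𝟙 (f x ≟ y) * g y)  ≡⟨ ∑-cong m (λ {y} _ → *-distribʳ-∑ m (g y) _) ⟨
    ∑[ y < m ] (fibre y * g y)                 ≡⟨ ∑-cong m (λ y<m → cong (_* _) (fibre≡1 y<m)) ⟩
    ∑[ y < m ] (1 * g y)                       ≡⟨ ∑-cong m (λ {y} _ → *-identityˡ (g y)) ⟩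
    ∑< m g                                     ∎
    where open ≡-Reasoning

Periodic : ℕ → (ℕ → ℕ) → Set
Periodic m g = ∀ x → g (m + x) ≡ g x

module _ {m} {g : ℕ → ℕ} (periodic : Periodic m g) where

  periodic-*+ : ∀ q r → g (m * q + r) ≡ g r
  periodic-*+ zero    r = cong (λ a → g (a + r)) (*-zeroʳ m)
  periodic-*+ (suc q) r = begin
    g (m * suc q + r)    ≡⟨ cong (λ a → g (a + r)) (*-suc m q) ⟩
    g (m + m * q + r)    ≡⟨ cong g (+-assoc m (m * q) r) ⟩
    g (m + (m * q + r))  ≡⟨ periodic (m * q + r) ⟩
    g (m * q + r)        ≡⟨ periodic-*+ q r ⟩
    g r                  ∎
    where open ≡-Reasoning

  periodic-% : .{{_ : NonZero m}} → ∀ x → g (x % m) ≡ g x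
  periodic-% x = trans (sym (periodic-*+ (x / m) (x % m))) (cong g (sym x≡m*[x/m]+x%m))
    where
    x≡m*[x/m]+x%m : x ≡ m * (x / m) + x % m
    x≡m*[x/m]+x%m = trans (m≡m%n+[m/n]*n x m)
                          (trans (+-comm (x % m) _) (cong (_+ x % m) (*-comm (x / m) m)))

  ∑-periodic : ∀ k → ∑[ a < k * m ] g a ≡ k * ∑< m g
  ∑-periodic k = begin
    ∑[ a < k * m ] g a                     ≡⟨ ∑-blocks k m g ⟩
    ∑[ q < k ] ∑[ r < m ] g (m * q + r)    ≡⟨ ∑-cong k (λ {q} _ → ∑-cong m (λ {r} _ → periodic-*+ q r)) ⟩
    ∑[ q < k ] ∑< m g                      ≡⟨ ∑-const k (∑< m g) ⟩
    k * ∑< m g                             ∎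
    where open ≡-Reasoning

[m+n]%d≡m%d⇒d∣n : ∀ m n d .{{_ : NonZero d}} → (m + n) % d ≡ m % d → d ∣ n
[m+n]%d≡m%d⇒d∣n m n d eq = divides ((m + n) / d ∸ m / d) (begin
  n
    ≡⟨ m+n∸m≡n m n ⟨
  (m + n) ∸ m
    ≡⟨ cong₂ _∸_ (m≡m%n+[m/n]*n (m + n) d) (m≡m%n+[m/n]*n m d) ⟩
  ((m + n) % d + (m + n) / d * d) ∸ (m % d + m / d * d)
    ≡⟨ cong (λ r → (r + (m + n) / d * d) ∸ (m % d + m / d * d)) eq ⟩
  (m % d + (m + n) / d * d) ∸ (m % d + m / d * d)
    ≡⟨ [m+n]∸[m+o]≡n∸o (m % d) _ _ ⟩
  (m + n) / d * d ∸ m / d * d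
    ≡⟨ *-distribʳ-∸ d ((m + n) / d) (m / d) ⟨
  ((m + n) / d ∸ m / d) * d ∎)
  where open ≡-Reasoning

∣∧<⇒≡0 : ∀ {m n} → m ∣ n → n < m → n ≡ 0
∣∧<⇒≡0 {n = zero}  _   _   = refl
∣∧<⇒≡0 {n = suc _} m∣n n<m = contradiction m∣n (>⇒∤ n<m)

module _ {m n} .{{_ : NonZero m}} (coprime : Coprime m n) where

  private
    affine-%-injective-≤ : ∀ r {q q′} → q ≤ q′ → q′ < m →
                           (n * q + r) % m ≡ (n * q′ + r) % m → q ≡ q′
    affine-%-injective-≤ r {q} q≤q′ q′<m eq with m≤n⇒∃[o]m+o≡n q≤q′
    ... | d , refl = sym (trans (cong (q +_) d≡0) (+-identityʳ q))
      where
      shift : ∀ n q d r → n * (q + d) + r ≡ (n * q + r) + n * d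
      shift = solve-∀
      m∣nd : m ∣ n * d
      m∣nd = [m+n]%d≡m%d⇒d∣n (n * q + r) (n * d) m
                             (trans (cong (_% m) (sym (shift n q d r))) (sym eq))
      d≡0 : d ≡ 0
      d≡0 = ∣∧<⇒≡0 (coprime-divisor coprime m∣nd) (≤-<-trans (m≤n+m d q) q′<m)

  affine-%-injective : ∀ r {q q′} → q < m → q′ < m →
                       (n * q + r) % m ≡ (n * q′ + r) % m → q ≡ q′
  affine-%-injective r {q} {q′} q<m q′<m eq with ≤-total q q′
  ... | inj₁ q≤q′ = affine-%-injective-≤ r q≤q′ q′<m eq
  ... | inj₂ q′≤q = sym (affine-%-injective-≤ r q′≤q q<m (sym eq))

  ∑-affine : ∀ {g} → Periodic m g → ∀ r → ∑[ q < m ] g (n * q + r) ≡ ∑< m g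
  ∑-affine {g} periodic r = begin
    ∑[ q < m ] g (n * q + r)        ≡⟨ ∑-cong m (λ {q} _ → periodic-% periodic (n * q + r)) ⟨
    ∑[ q < m ] g ((n * q + r) % m)  ≡⟨ ∑-reindex (λ {q} _ → m%n<n (n * q + r) m) (affine-%-injective r) g ⟩
    ∑< m g                          ∎
    where open ≡-Reasoning

  ∑-coprime-* : ∀ {g h} → Periodic m g → Periodic n h →
                ∑[ a < m * n ] (g a * h a) ≡ ∑< m g * ∑< n h
  ∑-coprime-* {g} {h} g-periodic h-periodic = begin
    ∑[ a < m * n ] (g a * h a)
      ≡⟨ ∑-blocks m n _ ⟩
    ∑[ q < m ] ∑[ r < n ] (g (n * q + r) * h (n * q + r))
      ≡⟨ ∑-cong m (λ {q} _ → ∑-cong n (h-reduce q)) ⟩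
    ∑[ q < m ] ∑[ r < n ] (g (n * q + r) * h r)
      ≡⟨ ∑-comm m n _ ⟩
    ∑[ r < n ] ∑[ q < m ] (g (n * q + r) * h r)
      ≡⟨ ∑-cong n (λ {r} _ → *-distribʳ-∑ m (h r) _) ⟨
    ∑[ r < n ] ((∑[ q < m ] g (n * q + r)) * h r)
      ≡⟨ ∑-cong n (λ {r} _ → cong (_* h r) (∑-affine g-periodic r)) ⟩
    ∑[ r < n ] (∑< m g * h r)
      ≡⟨ *-distribˡ-∑ n (∑< m g) h ⟨
    ∑< m g * ∑< n h ∎
    where
    open ≡-Reasoning
    h-reduce : ∀ q {r} → r < n → g (n * q + r) * h (n * q + r) ≡ g (n * q + r) * h r
    h-reduce q {r} _ = cong (g (n * q + r) *_) (periodic-*+ h-periodic q r)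

coprime-∣⇒*∣ : ∀ {m n x} → Coprime m n → m ∣ x → n ∣ x → m * n ∣ x
coprime-∣⇒*∣ {m} {n} coprime (divides q refl) n∣qm
  with coprime-divisor (Coprimality.sym coprime) (subst (n ∣_) (*-comm q m) n∣qm)
... | divides r refl = divides r (trans (*-assoc r n m) (cong (r *_) (*-comm n m)))

prime∤⇒coprime : ∀ {p m} → Prime p → p ∤ m → Coprime p m
prime∤⇒coprime pp p∤m (d∣p , d∣m) with prime⇒irreducible pp d∣p
... | inj₁ d≡1 = d≡1
... | inj₂ refl = contradiction d∣m p∤m

coprime-*ˡ : ∀ {a b m} → Coprime a m → Coprime b m → Coprime (a * b) m
coprime-*ˡ a⊥m b⊥m {d} (d∣ab , d∣m) = b⊥m (coprime-divisor d⊥a d∣ab , d∣m)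
  where
  d⊥a : Coprime d _
  d⊥a (e∣d , e∣a) = a⊥m (e∣a , ∣-trans e∣d d∣m)

coprime-^ˡ : ∀ {a m} → Coprime a m → ∀ e → Coprime (a ^ e) m
coprime-^ˡ a⊥m zero    (d∣1 , _) = ∣1⇒≡1 d∣1
coprime-^ˡ a⊥m (suc e) = coprime-*ˡ a⊥m (coprime-^ˡ a⊥m e)

prime^suc>1 : ∀ {p} → Prime p → ∀ e → 1 < p ^ suc e
prime^suc>1 {p} pp e = ≤-trans (nonTrivial⇒n>1 p {{prime⇒nonTrivial pp}}) (m≤m*n p (p ^ e))
  where
  instance
    _ = prime⇒nonZero pp
    _ = m^n≢0 p e

prime-factor : ∀ n → .{{_ : NonTrivial n}} → ∃ λ p → Prime p × p ∣ n
prime-factor n@(suc (suc _)) with factorise n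
... | record { factors = p ∷ _ ; isFactorisation = n≡ ; factorsPrime = pp All.∷ _ } =
  p , pp , subst (p ∣_) (sym n≡) (m∣m*n _)

prime-power-decomposition : ∀ {p} → Prime p → ∀ n → .{{_ : NonZero n}} →
                            ∃₂ λ e m → p ∤ m × n ≡ p ^ e * m
prime-power-decomposition {p} pp n = go n (<-wellFounded n)
  where
  reassociate : ∀ a m p → a * m * p ≡ p * a * m
  reassociate = solve-∀
  go : ∀ n → .{{_ : NonZero n}} → Acc _<_ n → ∃₂ λ e m → p ∤ m × n ≡ p ^ e * m
  go n (acc rec) with p ∣? n
  ... | no p∤n = 0 , n , p∤n , sym (*-identityˡ n)
  ... | yes (divides q refl) with go q {{m*n≢0⇒m≢0 q}} (rec (m<m*n q p {{m*n≢0⇒m≢0 q}} 1<p))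
    where
    1<p : 1 < p
    1<p = nonTrivial⇒n>1 p {{prime⇒nonTrivial pp}}
  ...   | e , m , p∤m , q≡ = suc e , m , p∤m , trans (cong (_* p) q≡) (reassociate (p ^ e) m p)

primeDivisor? : ∀ n q → Dec (Prime q × q ∣ n)
primeDivisor? n q = prime? q ×-dec q ∣? n

∑-primeDivisors≡ω : ∀ {n} B .{{_ : NonZero n}} → n < B → ∑[ q < B ] 𝟙 (primeDivisor? n q) ≡ ω n
∑-primeDivisors≡ω {n} B n<B with m≤n⇒∃[o]m+o≡n n<B
... | k , refl = begin
  ∑[ q < suc n + k ] 𝟙 (primeDivisor? n q)
    ≡⟨ ∑-split (suc n) k _ ⟩
  ∑[ q < suc n ] 𝟙 (primeDivisor? n q) + ∑[ j < k ] 𝟙 (primeDivisor? n (suc n + j))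
    ≡⟨ cong (_ +_) (∑-zero k too-large) ⟩
  ∑[ q < suc n ] 𝟙 (primeDivisor? n q) + 0
    ≡⟨ +-identityʳ _ ⟩
  ∑[ q < suc n ] 𝟙 (primeDivisor? n q)
    ≡⟨ length-filter-upTo (primeDivisor? n) (suc n) ⟨
  ω n ∎
  where
  open ≡-Reasoning
  too-large : ∀ {j} → j < k → 𝟙 (primeDivisor? n (suc n + j)) ≡ 0
  too-large {j} _ = 𝟙-no _ (λ (_ , q∣n) → >⇒∤ (s≤s (m≤m+n n j)) q∣n)

module _ {p m} (pp : Prime p) (p∤m : p ∤ m) (e : ℕ) where

  private
    instance
      _ = prime⇒nonZero pp
      _ = m^n≢0 p (suc e)

  primeDivisor-prime^* : ∀ q → 𝟙 (primeDivisor? (p ^ suc e * m) q) ≡ 𝟙 (primeDivisor? m q) + 𝟙 (p ≟ q)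
  primeDivisor-prime^* q with p ≟ q
  ... | yes refl = trans (𝟙-yes (primeDivisor? _ p) (pp , ∣m⇒∣m*n m (m∣m*n (p ^ e))))
                         (cong (_+ 1) (sym (𝟙-no (primeDivisor? m p) (p∤m ∘ proj₂))))
  ... | no p≢q  = trans (𝟙-cong _ _ (λ (pq , q∣) → pq , coprime-divisor (q⊥p^[1+e] pq) q∣)
                                    (λ (pq , q∣m) → pq , ∣n⇒∣m*n (p ^ suc e) q∣m))
                        (sym (+-identityʳ _))
    where
    q⊥p^[1+e] : Prime q → Coprime q (p ^ suc e)
    q⊥p^[1+e] pq = Coprimality.sym (coprime-^ˡ (prime∤⇒coprime pp p∤q) (suc e))
      where
      p∤q : p ∤ q
      p∤q p∣q with prime⇒irreducible pq p∣q
      ... | inj₁ refl = ¬prime[1] pp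
      ... | inj₂ p≡q  = p≢q p≡q

  ω-prime^* : .{{_ : NonZero m}} → ω (p ^ suc e * m) ≡ suc (ω m)
  ω-prime^* = begin
    ω N
      ≡⟨ length-filter-upTo (primeDivisor? N) (suc N) ⟩
    ∑[ q < suc N ] 𝟙 (primeDivisor? N q)
      ≡⟨ ∑-cong (suc N) (λ {q} _ → primeDivisor-prime^* q) ⟩
    ∑[ q < suc N ] (𝟙 (primeDivisor? m q) + 𝟙 (p ≟ q))
      ≡⟨ ∑-distrib-+ (suc N) _ _ ⟩
    ∑[ q < suc N ] 𝟙 (primeDivisor? m q) + ∑[ q < suc N ] 𝟙 (p ≟ q)
      ≡⟨ cong₂ _+_ (∑-primeDivisors≡ω (suc N) (s≤s (m≤n*m m (p ^ suc e))))
                   (∑-δ (suc N) (s≤s (∣⇒≤ p∣N))) ⟩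
    ω m + 1
      ≡⟨ +-comm (ω m) 1 ⟩
    suc (ω m) ∎
    where
    open ≡-Reasoning
    N = p ^ suc e * m
    instance _ = m*n≢0 (p ^ suc e) m
    p∣N : p ∣ N
    p∣N = ∣m⇒∣m*n m (m∣m*n (p ^ e))

pronic : ℕ → ℕ
pronic b = b * suc b

pronicRoots : ℕ → ℕ
pronicRoots n = ∑[ b < n ] 𝟙 (n ∣? pronic b)

∣pronic-periodic : ∀ n → Periodic n (λ b → 𝟙 (n ∣? pronic b))
∣pronic-periodic n b = 𝟙-cong _ _
  (λ n∣ → ∣m+n∣m⇒∣n (subst (n ∣_) (expand n b) n∣) (m∣m*n _))
  (λ n∣ → subst (n ∣_) (sym (expand n b)) (∣m∣n⇒∣m+n (m∣m*n _) n∣))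
  where
  expand : ∀ n b → (n + b) * suc (n + b) ≡ n * (n + b + suc b) + b * suc b
  expand = solve-∀

pronicRoots-* : ∀ {m n} .{{_ : NonZero m}} → Coprime m n →
                pronicRoots (m * n) ≡ pronicRoots m * pronicRoots n
pronicRoots-* {m} {n} coprime = trans (∑-cong (m * n) (λ {b} _ → both-divide b))
                                      (∑-coprime-* coprime (∣pronic-periodic m) (∣pronic-periodic n))
  where
  both-divide : ∀ b → 𝟙 (m * n ∣? pronic b) ≡ 𝟙 (m ∣? pronic b) * 𝟙 (n ∣? pronic b)
  both-divide b = trans (𝟙-cong _ ((m ∣? pronic b) ×-dec (n ∣? pronic b))
                          (λ mn∣ → m*n∣⇒m∣ m n mn∣ , m*n∣⇒n∣ m n mn∣)
                          (λ (m∣ , n∣) → coprime-∣⇒*∣ coprime m∣ n∣))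
                        (𝟙-×-dec (m ∣? pronic b) (n ∣? pronic b))

pronicRoots≡2 : ∀ {n} → 2 ≤ n → (∀ {b} → n ∣ pronic b → n ∣ b ⊎ n ∣ suc b) → pronicRoots n ≡ 2
pronicRoots≡2 {1} (s≤s ()) _
pronicRoots≡2 {n@(suc (suc k))} _ split = begin
  ∑< (1 + k) root + root (suc k)
    ≡⟨ cong (_+ root (suc k)) (∑-split 1 k root) ⟩
  root 0 + ∑[ j < k ] root (1 + j) + root (suc k)
    ≡⟨ cong₂ _+_ (cong₂ _+_ root-0 (∑-zero k no-root-between)) root-[n-1] ⟩
  1 + 0 + 1 ∎
  where
  open ≡-Reasoning
  root : ℕ → ℕ
  root b = 𝟙 (n ∣? pronic b)
  root-0 : root 0 ≡ 1
  root-0 = 𝟙-yes (n ∣? 0) (n ∣0)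
  root-[n-1] : root (suc k) ≡ 1
  root-[n-1] = 𝟙-yes (n ∣? pronic (suc k)) (n∣m*n (suc k))
  no-root-between : ∀ {j} → j < k → root (1 + j) ≡ 0
  no-root-between j<k = 𝟙-no (n ∣? _) λ n∣ → case split n∣ of λ where
    (inj₁ n∣1+j) → >⇒∤ (s≤s (s≤s (<⇒≤ j<k))) n∣1+j
    (inj₂ n∣2+j) → >⇒∤ (s≤s (s≤s j<k)) n∣2+j

prime^∣pronic : ∀ {p} → Prime p → ∀ e {b} → p ^ e ∣ pronic b → p ^ e ∣ b ⊎ p ^ e ∣ suc b
prime^∣pronic {p} pp e {b} p^e∣ with p ∣? b
... | yes p∣b = inj₁ (coprime-divisor (coprime-^ˡ (prime∤⇒coprime pp p∤1+b) e)
                                      (subst (p ^ e ∣_) (*-comm b (suc b)) p^e∣))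
  where
  p∤1+b : p ∤ suc b
  p∤1+b p∣1+b = ¬prime[1] (subst Prime (∣1⇒≡1 (∣m+n∣m⇒∣n (subst (p ∣_) (+-comm 1 b) p∣1+b) p∣b)) pp)
... | no p∤b  = inj₂ (coprime-divisor (coprime-^ˡ (prime∤⇒coprime pp p∤b) e) p^e∣)

pronicRoots-prime^ : ∀ {p} → Prime p → ∀ e → pronicRoots (p ^ suc e) ≡ 2
pronicRoots-prime^ pp e = pronicRoots≡2 (prime^suc>1 pp e) (prime^∣pronic pp (suc e))

pronicRoots≡2^ω-prime^* : ∀ {p m} → Prime p → p ∤ m → ∀ e .{{_ : NonZero m}} →
                          pronicRoots m ≡ 2 ^ ω m → pronicRoots (p ^ suc e * m) ≡ 2 ^ ω (p ^ suc e * m)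
pronicRoots≡2^ω-prime^* {p} {m} pp p∤m e ih = begin
  pronicRoots (p ^ suc e * m)              ≡⟨ pronicRoots-* (coprime-^ˡ (prime∤⇒coprime pp p∤m) (suc e)) ⟩
  pronicRoots (p ^ suc e) * pronicRoots m  ≡⟨ cong₂ _*_ (pronicRoots-prime^ pp e) ih ⟩
  2 ^ suc (ω m)                            ≡⟨ cong (2 ^_) (ω-prime^* pp p∤m e) ⟨
  2 ^ ω (p ^ suc e * m)                    ∎
  where
  open ≡-Reasoning
  instance
    _ = prime⇒nonZero pp
    _ = m^n≢0 p (suc e)

pronicRoots≡2^ω : ∀ n → .{{_ : NonZero n}} → pronicRoots n ≡ 2 ^ ω n
pronicRoots≡2^ω n = go n (<-wellFounded n)
  where
  go : ∀ n → .{{_ : NonZero n}} → Acc _<_ n → pronicRoots n ≡ 2 ^ ω n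
  go 1 _ = refl
  go n@(suc (suc _)) (acc rec) with prime-factor n
  ... | p , pp , p∣n with prime-power-decomposition pp n
  ...   | zero  , m         , p∤m , n≡ = contradiction (subst (p ∣_) (trans n≡ (*-identityˡ m)) p∣n) p∤m
  ...   | suc e , zero      , _   , n≡ = contradiction (trans n≡ (*-zeroʳ (p ^ suc e))) λ ()
  ...   | suc e , m@(suc _) , p∤m , n≡ = subst (λ n → pronicRoots n ≡ 2 ^ ω n) (sym n≡)
                                           (pronicRoots≡2^ω-prime^* pp p∤m e (go m (rec m<n)))
    where
    m<n : m < n
    m<n = subst (m <_) (trans (*-comm m _) (sym n≡)) (m<m*n m (p ^ suc e) (prime^suc>1 pp e))

even²%≢1 : ∀ {M a} .{{_ : NonZero M}} → 2 ∣ M → 2 ∣ a → a * a % M ≢ 1 % M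
even²%≢1 {M} {a} 2∣M 2∣a a²≡1 = 0≢1+n (begin
  0              ≡⟨ n∣m⇒m%n≡0 (a * a) 2 (∣m⇒∣m*n a 2∣a) ⟨
  a * a % 2      ≡⟨ m∣n⇒o%n%m≡o%m 2 M (a * a) 2∣M ⟨
  a * a % M % 2  ≡⟨ cong (_% 2) a²≡1 ⟩
  1 % M % 2      ≡⟨ m∣n⇒o%n%m≡o%m 2 M 1 2∣M ⟩
  1              ∎)
  where open ≡-Reasoning

𝒩[4n]≡2*pronicRoots : ∀ n → 𝒩 (4 * suc n) ≡ 2 * pronicRoots (suc n)
𝒩[4n]≡2*pronicRoots n = begin
  𝒩 M                                       ≡⟨ length-filter-upTo (λ a → a * a % M ≟ 1 % M) M ⟩
  ∑[ a < M ] unit a                         ≡⟨ cong (λ k → ∑< k unit) (regroup N) ⟩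
  ∑[ a < 2 * N * 2 ] unit a                 ≡⟨ ∑-blocks (2 * N) 2 unit ⟩
  ∑[ b < 2 * N ] ∑[ r < 2 ] unit (2 * b + r) ≡⟨ ∑-cong (2 * N) (λ {b} _ → cong₂ _+_ (even b) (odd b)) ⟩
  ∑[ b < 2 * N ] 𝟙 (N ∣? pronic b)          ≡⟨ ∑-periodic {N} (∣pronic-periodic N) 2 ⟩
  2 * pronicRoots N                         ∎
  where
  open ≡-Reasoning
  N = suc n
  M = 4 * N
  unit : ℕ → ℕ
  unit a = 𝟙 (a * a % M ≟ 1 % M)
  regroup : ∀ N → 4 * N ≡ 2 * N * 2
  regroup = solve-∀
  square-odd : ∀ b → (2 * b + 1) * (2 * b + 1) ≡ 1 + 4 * (b * suc b)
  square-odd = solve-∀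
  even : ∀ b → unit (2 * b + 0) ≡ 0
  even b = 𝟙-no _ (even²%≢1 (∣m⇒∣m*n N (divides 2 refl)) (∣m∣n⇒∣m+n (m∣m*n b) (2 ∣0)))
  odd : ∀ b → unit (2 * b + 1) ≡ 𝟙 (N ∣? pronic b)
  odd b = 𝟙-cong _ _
    (λ a²≡1 → *-cancelˡ-∣ 4 ([m+n]%d≡m%d⇒d∣n 1 (4 * pronic b) M
                                (trans (cong (_% M) (sym (square-odd b))) a²≡1)))
    (λ N∣ → trans (cong (_% M) (square-odd b)) (%-remove-+ʳ 1 (*-monoʳ-∣ 4 N∣)))

n<2^n : ∀ n → n < 2 ^ n
n<2^n zero    = s≤s z≤n
n<2^n (suc n) = subst (_≤ 2 ^ suc n) (+-comm (suc n) 1) (+-mono-≤ (n<2^n n) 1≤2^n+0)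
  where
  1≤2^n+0 : 1 ≤ 2 ^ n + 0
  1≤2^n+0 = subst (1 ≤_) (sym (+-identityʳ (2 ^ n))) (m^n>0 2 n)

ν₂-go-2^ : ∀ {fuel} k → k < fuel → ν₂-go fuel (2 ^ k) ≡ k
ν₂-go-2^ {suc fuel} zero    _ = refl
ν₂-go-2^ {suc fuel} (suc k) k<1+fuel with 2 ^ suc k % 2 ≟ 0
... | yes _    = cong suc (trans (cong (ν₂-go fuel) halve) (ν₂-go-2^ k (s≤s⁻¹ k<1+fuel)))
  where
  halve : 2 ^ suc k / 2 ≡ 2 ^ k
  halve = trans (cong (_/ 2) (*-comm 2 (2 ^ k))) (m*n/n≡m (2 ^ k) 2)
... | no ¬even = contradiction (n∣m⇒m%n≡0 (2 ^ suc k) 2 (m∣m*n (2 ^ k))) ¬even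

ν₂-2^ : ∀ k → ν₂ (2 ^ k) ≡ k
ν₂-2^ k = ν₂-go-2^ k (n<2^n k)

mainTheorem6 : (n : ℕ) → ω (suc n) ≡ ν₂ (𝒩 (4 * suc n)) ∸ 1
mainTheorem6 n = sym (begin
  ν₂ (𝒩 (4 * suc n)) ∸ 1           ≡⟨ cong (λ k → ν₂ k ∸ 1) (𝒩[4n]≡2*pronicRoots n) ⟩
  ν₂ (2 * pronicRoots (suc n)) ∸ 1  ≡⟨ cong (λ k → ν₂ (2 * k) ∸ 1) (pronicRoots≡2^ω (suc n)) ⟩
  ν₂ (2 ^ suc (ω (suc n))) ∸ 1      ≡⟨ cong (_∸ 1) (ν₂-2^ (suc (ω (suc n)))) ⟩
  ω (suc n)                         ∎)
  where open ≡-Reasoning
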